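{- Let $A=\{a_s(n_s)\}_{s=1}^k$ be an exact covering system such that the least common multiple of all its moduli is $p_1^{k_1}p_2^{k_2}p_3^{k_3}$, where $p_1,p_2,p_3$ are distinct primes and $k_1,k_2,k_3\ge 0$ are integers. Assume there exist moduli $n_1,n_2,n_3$ of $A$ such that $p_1\mid n_1n_2$, $p_2\mid n_1n_3$, $p_3\mid n_2n_3$, $p_1\nmid n_3$, $p_2\nmid n_2$, and $p_3\nmid n_1$. Then $p_1p_2p_3$ divides some modulus of $A$.
   Context: For integers $a$ and $n\geq 1$, $a(n)$ denotes the arithmetic progression $a+n\mathbb{Z}$, and $n$ is its modulus. An exact covering system (ECS) is a finite list $\{a_s(n_s)\}_{s=1}^k$ of arithmetic progressions (repetitions of moduli allowed) which partitions $\mathbb{Z}$, i.e. every integer lies in exactly one of them. -}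

module Defs where

open import Data.Nat using (ℕ; _≤_)
open import Data.Nat.LCM using (lcm)
open import Data.Integer using (ℤ; +_; _-_)
open import Data.Integer.Divisibility using () renaming (_∣_ to _∣ℤ_)
open import Data.Fin using (Fin)
open import Data.List using (foldr; tabulate)
open import Data.Product using (Σ; _×_)
open import Relation.Binary.PropositionalEquality using (_≡_)

_∈AP_,_ : ℤ → ℤ → ℕ → Set
x ∈AP a , n = (+ n) ∣ℤ (x - a)

IsECS : (k : ℕ) → (Fin k → ℤ) → (Fin k → ℕ) → Set
IsECS k a n =
  ((s : Fin k) → 1 ≤ n s) ×
  ((x : ℤ) → Σ (Fin k) (λ s → x ∈AP a s , n s)) ×
  ((x : ℤ) (s t : Fin k) → x ∈AP a s , n s → x ∈AP a t , n t → s ≡ t)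

lcmAll : (k : ℕ) → (Fin k → ℕ) → ℕ
lcmAll k n = foldr lcm 1 (tabulate n)

-- Write Qⱼ = pⱼ^kⱼ and let Mⱼ be the product of the other two Qᵢ.  By the Chinese
-- remainder theorem an integer is a point (x₁, x₂, x₃) of ℤ/Q₁ × ℤ/Q₂ × ℤ/Q₃; we realise
-- this with integers t₁ + t₂ + t₃ = 1, Mⱼ ∣ tⱼ (a "splitting of 1"), the point with
-- coordinates bⱼ being b₁t₁ + b₂t₂ + b₃t₃.  Two points agreeing off coordinate j are
-- congruent mod Mⱼ, and a progression whose modulus is prime to pⱼ divides Mⱼ, so it is
-- a union of lines in direction j.  Progression iⱼ contains aⱼ, hence the corners
-- y₁ = (a₁,a₁,a₂), y₂ = (a₂,a₃,a₂), y₃ = (a₁,a₃,a₃).  The point R = (a₁,a₃,a₂) lies on a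
-- line through each corner; if the progression B containing R had modulus prime to pⱼ,
-- exactness would force B and two of the iᵢ to coincide, contradicting pⱼ ∣ nᵢ nᵢ'.
module Submission where

open import Defs
open import Data.Nat using (ℕ; zero; suc; _*_; _^_)
import Data.Nat as ℕ
import Data.Nat.Properties as ℕ
open import Data.Nat.Divisibility using (_∣_; _∣?_; ∣-trans; ∣1⇒≡1; ∣m⇒∣m*n; *-pres-∣)
open import Data.Nat.Primality using (Prime; prime⇒irreducible; ¬prime[1]; euclidsLemma)
open import Data.Nat.Coprimality as Coprimality
  using (Coprime; coprime-divisor; coprime-Bézout; coprime⇒gcd≡1; gcd≡1⇒coprime)
open import Data.Nat.GCD using (gcd; gcd[m,n]∣m; gcd[m,n]∣n; module Bézout)
open import Data.Nat.LCM using (lcm; m∣lcm[m,n]; n∣lcm[m,n]; lcm-least; gcd*lcm)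
open import Data.Fin using (Fin)
open import Data.Integer using (ℤ; +_; _+_; _-_; -_; ∣_∣) renaming (_*_ to _*ᶻ_)
import Data.Integer.Properties as ℤ
open import Data.Integer.Divisibility using () renaming (_∣_ to _∣ℤ_)
import Data.Integer.Divisibility.Signed as Signed
open import Data.Integer.Tactic.RingSolver using (solve-∀)
open import Data.Product using (Σ; _,_; proj₁; proj₂; _×_; map₂)
open import Data.Sum using (inj₁; inj₂)
open import Relation.Nullary using (¬_; yes; no; contradiction)
open import Relation.Binary.PropositionalEquality
  using (_≡_; _≢_; refl; sym; trans; cong; subst; ≢-sym; module ≡-Reasoning)
open ≡-Reasoning

prime∤⇒coprime : ∀ {p m} → Prime p → ¬ (p ∣ m) → Coprime p m
prime∤⇒coprime pp p∤m (d∣p , d∣m) with prime⇒irreducible pp d∣p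
... | inj₁ d≡1 = d≡1
... | inj₂ refl = contradiction d∣m p∤m

distinctPrimes⇒coprime : ∀ {p q} → Prime p → Prime q → p ≢ q → Coprime p q
distinctPrimes⇒coprime {p} {q} pp pq p≢q = prime∤⇒coprime pp p∤q
  where
  p∤q : ¬ (p ∣ q)
  p∤q p∣q with prime⇒irreducible pq p∣q
  ... | inj₁ refl = ¬prime[1] pp
  ... | inj₂ p≡q = p≢q p≡q

coprime-*ˡ : ∀ {a b m} → Coprime a m → Coprime b m → Coprime (a * b) m
coprime-*ˡ {a} {b} a⊥m b⊥m {d} (d∣ab , d∣m) = b⊥m (coprime-divisor d⊥a d∣ab , d∣m)
  where
  d⊥a : Coprime d a
  d⊥a = gcd≡1⇒coprime (a⊥m (gcd[m,n]∣n d a , ∣-trans (gcd[m,n]∣m d a) d∣m))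

coprime-^ˡ : ∀ {a m} e → Coprime a m → Coprime (a ^ e) m
coprime-^ˡ zero    a⊥m (d∣1 , _) = ∣1⇒≡1 d∣1
coprime-^ˡ (suc e) a⊥m = coprime-*ˡ a⊥m (coprime-^ˡ e a⊥m)

primePowers-coprime : ∀ {p q} → Prime p → Prime q → p ≢ q → ∀ e f → Coprime (p ^ e) (q ^ f)
primePowers-coprime pp pq p≢q e f =
  coprime-^ˡ e (Coprimality.sym (coprime-^ˡ f (Coprimality.sym (distinctPrimes⇒coprime pp pq p≢q))))

cofactor : ∀ {p m} e Y → Prime p → ¬ (p ∣ m) → m ∣ p ^ e * Y → m ∣ Y
cofactor e Y pp p∤m = coprime-divisor (Coprimality.sym (coprime-^ˡ e (prime∤⇒coprime pp p∤m)))

coprime⇒*∣ : ∀ {a b m} → Coprime a b → a ∣ m → b ∣ m → a * b ∣ m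
coprime⇒*∣ {a} {b} a⊥b a∣m b∣m = subst (_∣ _) lcm≡ab (lcm-least a∣m b∣m)
  where
  lcm≡ab : lcm a b ≡ a * b
  lcm≡ab = begin
    lcm a b           ≡⟨ ℕ.*-identityˡ (lcm a b) ⟨
    1 * lcm a b       ≡⟨ cong (_* lcm a b) (coprime⇒gcd≡1 a⊥b) ⟨
    gcd a b * lcm a b ≡⟨ gcd*lcm a b ⟩
    a * b             ∎

distinctPrimes∣⇒product∣ : ∀ {p₁ p₂ p₃ m} → Prime p₁ → Prime p₂ → Prime p₃ →
  p₁ ≢ p₂ → p₁ ≢ p₃ → p₂ ≢ p₃ → (p₁ ∣ m) × (p₂ ∣ m) × (p₃ ∣ m) → p₁ * p₂ * p₃ ∣ m
distinctPrimes∣⇒product∣ {p₁} {p₂} {p₃} pp₁ pp₂ pp₃ p₁≢p₂ p₁≢p₃ p₂≢p₃ (p₁∣m , p₂∣m , p₃∣m) =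
  coprime⇒*∣ p₁p₂⊥p₃ (coprime⇒*∣ (distinctPrimes⇒coprime pp₁ pp₂ p₁≢p₂) p₁∣m p₂∣m) p₃∣m
  where
  p₁p₂⊥p₃ : Coprime (p₁ * p₂) p₃
  p₁p₂⊥p₃ = coprime-*ˡ (distinctPrimes⇒coprime pp₁ pp₃ p₁≢p₃) (distinctPrimes⇒coprime pp₂ pp₃ p₂≢p₃)

modulus∣lcmAll : ∀ k (n : Fin k → ℕ) s → n s ∣ lcmAll k n
modulus∣lcmAll (suc k) n Fin.zero    = m∣lcm[m,n] _ _
modulus∣lcmAll (suc k) n (Fin.suc s) =
  ∣-trans (modulus∣lcmAll k (λ i → n (Fin.suc i)) s) (n∣lcm[m,n] (n Fin.zero) _)

-- Congruences in ℤ: x ∈AP y , m says x ≡ y (mod m)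

∈AP-weaken : ∀ {m M x y} → m ∣ M → x ∈AP y , M → x ∈AP y , m
∈AP-weaken = ∣-trans

∈AP-shift : ∀ {m x y a} → x ∈AP a , m → x ∈AP y , m → y ∈AP a , m
∈AP-shift {m} {x} {y} {a} x∈a x≡y = Signed.∣⇒∣ᵤ (subst (+ m Signed.∣_) (difference x y a)
  (Signed.∣m∣n⇒∣m-n (Signed.∣ᵤ⇒∣ {i = x - a} x∈a) (Signed.∣ᵤ⇒∣ {i = x - y} x≡y)))
  where
  difference : ∀ x y a → (x - a) - (x - y) ≡ y - a
  difference = solve-∀

∈AP-multiple : ∀ {M} x y t d → x - y ≡ t *ᶻ d → + M ∣ℤ t → x ∈AP y , M
∈AP-multiple {M} x y t d x-y≡td M∣t = subst (M ∣_) (cong ∣_∣ (sym x-y≡td))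
  (subst (M ∣_) (sym (ℤ.abs-* t d)) (∣m⇒∣m*n ∣ d ∣ M∣t))

-- Splittings of 1

∣ℤ-multiple : ∀ u m → + m ∣ℤ u *ᶻ + m
∣ℤ-multiple u m = Signed.∣⇒∣ᵤ (Signed.divides u refl)

bézout-in-ℤ : ∀ x y m n → 1 ℕ.+ y * n ≡ x * m → + x *ᶻ + m + (- + y) *ᶻ + n ≡ + 1
bézout-in-ℤ x y m n eq = begin
  + x *ᶻ + m + (- + y) *ᶻ + n         ≡⟨ cong (_+ (- + y) *ᶻ + n) xm≡1+yn ⟩
  (+ 1 + + y *ᶻ + n) + (- + y) *ᶻ + n ≡⟨ cancel (+ y) (+ n) ⟩
  + 1                                 ∎
  where
  xm≡1+yn : + x *ᶻ + m ≡ + 1 + + y *ᶻ + n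
  xm≡1+yn = trans (sym (ℤ.pos-* x m))
    (trans (cong +_ (sym eq)) (cong (λ z → + 1 + z) (ℤ.pos-* y n)))
  cancel : ∀ u v → (+ 1 + u *ᶻ v) + (- u) *ᶻ v ≡ + 1
  cancel = solve-∀

coprime⇒split : ∀ {m n} → Coprime m n →
  Σ ℤ λ e → Σ ℤ λ f → e + f ≡ + 1 × + m ∣ℤ e × + n ∣ℤ f
coprime⇒split {m} {n} m⊥n with coprime-Bézout m⊥n
... | Bézout.+- x y eq =
  + x *ᶻ + m , (- + y) *ᶻ + n , bézout-in-ℤ x y m n eq ,
  ∣ℤ-multiple (+ x) m , ∣ℤ-multiple (- + y) n
... | Bézout.-+ x y eq =
  (- + x) *ᶻ + m , + y *ᶻ + n ,
  trans (ℤ.+-comm ((- + x) *ᶻ + m) (+ y *ᶻ + n)) (bézout-in-ℤ y x n m eq) ,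
  ∣ℤ-multiple (- + x) m , ∣ℤ-multiple (+ y) n

∣ℤ-* : ∀ a b x y → + a ∣ℤ x → + b ∣ℤ y → + (a * b) ∣ℤ x *ᶻ y
∣ℤ-* a b x y a∣x b∣y = subst (_ ∣_) (sym (ℤ.abs-* x y)) (*-pres-∣ a∣x b∣y)

-- A splitting of 1 along M₁, M₂, M₃: integers t₁ + t₂ + t₃ = 1 with Mⱼ ∣ tⱼ.
-- For pairwise coprime Q's and Mⱼ = ∏_{i≠j} Qᵢ these are the CRT idempotents.
record Splitting (M₁ M₂ M₃ : ℕ) : Set where
  field
    t₁ t₂ t₃ : ℤ
    sum≡1    : t₁ + t₂ + t₃ ≡ + 1
    M₁∣t₁    : + M₁ ∣ℤ t₁
    M₂∣t₂    : + M₂ ∣ℤ t₂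
    M₃∣t₃    : + M₃ ∣ℤ t₃

-- Splittings exist for Mⱼ the cofactors of pairwise coprime Q₁, Q₂, Q₃: split
-- 1 = e + f along Q₁, Q₂Q₃ and 1 = e' + f' along Q₂, Q₃, then 1 = f + e f' + e e'.
splitting : ∀ {Q₁ Q₂ Q₃} → Coprime Q₁ (Q₂ * Q₃) → Coprime Q₂ Q₃ →
  Splitting (Q₂ * Q₃) (Q₁ * Q₃) (Q₁ * Q₂)
splitting {Q₁} {Q₂} {Q₃} Q₁⊥Q₂Q₃ Q₂⊥Q₃ with coprime⇒split Q₁⊥Q₂Q₃ | coprime⇒split Q₂⊥Q₃
... | e , f , e+f≡1 , Q₁∣e , Q₂Q₃∣f | e′ , f′ , e′+f′≡1 , Q₂∣e′ , Q₃∣f′ = record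
  { t₁ = f ; t₂ = e *ᶻ f′ ; t₃ = e *ᶻ e′
  ; sum≡1 = sum≡1
  ; M₁∣t₁ = Q₂Q₃∣f
  ; M₂∣t₂ = ∣ℤ-* Q₁ Q₃ e f′ Q₁∣e Q₃∣f′
  ; M₃∣t₃ = ∣ℤ-* Q₁ Q₂ e e′ Q₁∣e Q₂∣e′
  }
  where
  sum≡1 : f + e *ᶻ f′ + e *ᶻ e′ ≡ + 1
  sum≡1 = begin
    f + e *ᶻ f′ + e *ᶻ e′ ≡⟨ regroup e f e′ f′ ⟩
    e *ᶻ (e′ + f′) + f    ≡⟨ cong (λ z → e *ᶻ z + f) e′+f′≡1 ⟩
    e *ᶻ + 1 + f          ≡⟨ cong (_+ f) (ℤ.*-identityʳ e) ⟩
    e + f                 ≡⟨ e+f≡1 ⟩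
    + 1                   ∎
    where
    regroup : ∀ e f e′ f′ → f + e *ᶻ f′ + e *ᶻ e′ ≡ e *ᶻ (e′ + f′) + f
    regroup = solve-∀

module Points {M₁ M₂ M₃ : ℕ} (S : Splitting M₁ M₂ M₃) where
  open Splitting S

  point : ℤ → ℤ → ℤ → ℤ
  point b₁ b₂ b₃ = b₁ *ᶻ t₁ + b₂ *ᶻ t₂ + b₃ *ᶻ t₃

  point-diagonal : ∀ c → point c c c ≡ c
  point-diagonal c = begin
    c *ᶻ t₁ + c *ᶻ t₂ + c *ᶻ t₃ ≡⟨ factor c t₁ t₂ t₃ ⟩
    c *ᶻ (t₁ + t₂ + t₃)         ≡⟨ cong (c *ᶻ_) sum≡1 ⟩
    c *ᶻ + 1                    ≡⟨ ℤ.*-identityʳ c ⟩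
    c                           ∎
    where
    factor : ∀ c t₁ t₂ t₃ → c *ᶻ t₁ + c *ᶻ t₂ + c *ᶻ t₃ ≡ c *ᶻ (t₁ + t₂ + t₃)
    factor = solve-∀

  congruent₁ : ∀ b₁ c₁ b₂ b₃ → point b₁ b₂ b₃ ∈AP point c₁ b₂ b₃ , M₁
  congruent₁ b₁ c₁ b₂ b₃ =
    ∈AP-multiple (point b₁ b₂ b₃) (point c₁ b₂ b₃) t₁ (b₁ - c₁)
      (difference b₁ c₁ b₂ b₃ t₁ t₂ t₃) M₁∣t₁
    where
    difference : ∀ b₁ c₁ b₂ b₃ t₁ t₂ t₃ →
      (b₁ *ᶻ t₁ + b₂ *ᶻ t₂ + b₃ *ᶻ t₃) - (c₁ *ᶻ t₁ + b₂ *ᶻ t₂ + b₃ *ᶻ t₃) ≡ t₁ *ᶻ (b₁ - c₁)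
    difference = solve-∀

  congruent₂ : ∀ b₁ b₂ c₂ b₃ → point b₁ b₂ b₃ ∈AP point b₁ c₂ b₃ , M₂
  congruent₂ b₁ b₂ c₂ b₃ =
    ∈AP-multiple (point b₁ b₂ b₃) (point b₁ c₂ b₃) t₂ (b₂ - c₂)
      (difference b₁ b₂ c₂ b₃ t₁ t₂ t₃) M₂∣t₂
    where
    difference : ∀ b₁ b₂ c₂ b₃ t₁ t₂ t₃ →
      (b₁ *ᶻ t₁ + b₂ *ᶻ t₂ + b₃ *ᶻ t₃) - (b₁ *ᶻ t₁ + c₂ *ᶻ t₂ + b₃ *ᶻ t₃) ≡ t₂ *ᶻ (b₂ - c₂)
    difference = solve-∀

  congruent₃ : ∀ b₁ b₂ b₃ c₃ → point b₁ b₂ b₃ ∈AP point b₁ b₂ c₃ , M₃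
  congruent₃ b₁ b₂ b₃ c₃ =
    ∈AP-multiple (point b₁ b₂ b₃) (point b₁ b₂ c₃) t₃ (b₃ - c₃)
      (difference b₁ b₂ b₃ c₃ t₁ t₂ t₃) M₃∣t₃
    where
    difference : ∀ b₁ b₂ b₃ c₃ t₁ t₂ t₃ →
      (b₁ *ᶻ t₁ + b₂ *ᶻ t₂ + b₃ *ᶻ t₃) - (b₁ *ᶻ t₁ + b₂ *ᶻ t₂ + c₃ *ᶻ t₃) ≡ t₃ *ᶻ (b₃ - c₃)
    difference = solve-∀

  on-line₁ : ∀ b c → point b c c ∈AP c , M₁
  on-line₁ b c = subst (λ z → point b c c ∈AP z , M₁) (point-diagonal c) (congruent₁ b c c c)

  on-line₂ : ∀ b c → point c b c ∈AP c , M₂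
  on-line₂ b c = subst (λ z → point c b c ∈AP z , M₂) (point-diagonal c) (congruent₂ c b c c)

  on-line₃ : ∀ b c → point c c b ∈AP c , M₃
  on-line₃ b c = subst (λ z → point c c b ∈AP z , M₃) (point-diagonal c) (congruent₃ c c b c)

-- Two consequences of exactness

module _ {k : ℕ} {a : Fin k → ℤ} {n : Fin k → ℕ}
  (unique : (x : ℤ) (s t : Fin k) → x ∈AP a s , n s → x ∈AP a t , n t → s ≡ t) where

  -- A progression whose modulus divides M is a union of residue classes mod M: if it
  -- contains x, then it is the progression containing any y ≡ x (mod M).
  sameProgression : ∀ {M} x y s t → n s ∣ M →
    x ∈AP a s , n s → x ∈AP y , M → y ∈AP a t , n t → s ≡ t
  sameProgression x y s t ns∣M x∈s x≡y y∈t =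
    unique y s t (∈AP-shift {x = x} {y} {a s} x∈s (∈AP-weaken {x = x} {y} ns∣M x≡y)) y∈t

  -- Let p ∣ nᵢ nⱼ, and let every modulus prime to p divide M.  If x lies in progression
  -- B, is ≡ mod M to a point of progression i, and ≡ mod M′ to a point of progression j,
  -- where nᵢ ∣ M′, then p ∣ n_B: otherwise exactness gives B = i = j.
  primeDividesProgression : ∀ {p M M′} x y z B i j → Prime p → p ∣ n i * n j →
    (∀ s → ¬ (p ∣ n s) → n s ∣ M) → n i ∣ M′ →
    x ∈AP a B , n B → x ∈AP y , M → y ∈AP a i , n i →
    x ∈AP z , M′ → z ∈AP a j , n j → p ∣ n B
  primeDividesProgression {p} x y z B i j pp p∣ninj avoid ni∣M′ x∈B x≡y y∈i x≡z z∈j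
    with p ∣? n B
  ... | yes p∣nB = p∣nB
  ... | no  p∤nB = contradiction (subst (λ s → p ∣ n s) (sym B≡i) p∣ni) p∤nB
    where
    B≡i : B ≡ i
    B≡i = sameProgression x y B i (avoid B p∤nB) x∈B x≡y y∈i
    i≡j : i ≡ j
    i≡j = sameProgression x z i j ni∣M′ (subst (λ s → x ∈AP a s , n s) B≡i x∈B) x≡z z∈j
    p∣ni : p ∣ n i
    p∣ni with euclidsLemma (n i) (n j) pp p∣ninj
    ... | inj₁ p∣ni = p∣ni
    ... | inj₂ p∣nj = subst (λ s → p ∣ n s) (sym i≡j) p∣nj

triangle : ∀ {k} {a : Fin k → ℤ} {n : Fin k → ℕ} {p₁ p₂ p₃ M₁ M₂ M₃} →
  IsECS k a n → Prime p₁ → Prime p₂ → Prime p₃ → Splitting M₁ M₂ M₃ →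
  (∀ s → ¬ (p₁ ∣ n s) → n s ∣ M₁) →
  (∀ s → ¬ (p₂ ∣ n s) → n s ∣ M₂) →
  (∀ s → ¬ (p₃ ∣ n s) → n s ∣ M₃) →
  (i₁ i₂ i₃ : Fin k) →
  p₁ ∣ n i₁ * n i₂ → p₂ ∣ n i₁ * n i₃ → p₃ ∣ n i₂ * n i₃ →
  ¬ (p₁ ∣ n i₃) → ¬ (p₂ ∣ n i₂) → ¬ (p₃ ∣ n i₁) →
  Σ (Fin k) λ B → (p₁ ∣ n B) × (p₂ ∣ n B) × (p₃ ∣ n B)
triangle {k} {a} {n} {p₁} {p₂} {p₃} {M₁} {M₂} {M₃} (_ , cover , unique) pp₁ pp₂ pp₃ S
  avoid₁ avoid₂ avoid₃ i₁ i₂ i₃ p₁∣n₁n₂ p₂∣n₁n₃ p₃∣n₂n₃ p₁∤n₃ p₂∤n₂ p₃∤n₁ = B , p₁∣nB , p₂∣nB , p₃∣nB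
  where
  open Points S
  a₁ a₂ a₃ : ℤ
  a₁ = a i₁
  a₂ = a i₂
  a₃ = a i₃

  -- R and the three corners; R differs from yⱼ in a single coordinate.
  R y₁ y₂ y₃ : ℤ
  R  = point a₁ a₃ a₂
  y₁ = point a₁ a₁ a₂
  y₂ = point a₂ a₃ a₂
  y₃ = point a₁ a₃ a₃

  B : Fin k
  B = proj₁ (cover R)
  R∈B : R ∈AP a B , n B
  R∈B = proj₂ (cover R)

  -- Corner yⱼ lies in progression iⱼ, whose modulus divides the relevant Mᵢ.
  y₁∈i₁ : y₁ ∈AP a₁ , n i₁
  y₁∈i₁ = ∈AP-weaken {x = y₁} {a₁} (avoid₃ i₁ p₃∤n₁) (on-line₃ a₂ a₁)
  y₂∈i₂ : y₂ ∈AP a₂ , n i₂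
  y₂∈i₂ = ∈AP-weaken {x = y₂} {a₂} (avoid₂ i₂ p₂∤n₂) (on-line₂ a₃ a₂)
  y₃∈i₃ : y₃ ∈AP a₃ , n i₃
  y₃∈i₃ = ∈AP-weaken {x = y₃} {a₃} (avoid₁ i₃ p₁∤n₃) (on-line₁ a₁ a₃)

  R≡y₁ : R ∈AP y₁ , M₂
  R≡y₁ = congruent₂ a₁ a₃ a₁ a₂
  R≡y₂ : R ∈AP y₂ , M₁
  R≡y₂ = congruent₁ a₁ a₂ a₃ a₂
  R≡y₃ : R ∈AP y₃ , M₃
  R≡y₃ = congruent₃ a₁ a₃ a₂ a₃

  p₁∣nB : p₁ ∣ n B
  p₁∣nB = primeDividesProgression unique R y₂ y₁ B i₂ i₁ pp₁
    (subst (p₁ ∣_) (ℕ.*-comm (n i₁) (n i₂)) p₁∣n₁n₂) avoid₁ (avoid₂ i₂ p₂∤n₂)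
    R∈B R≡y₂ y₂∈i₂ R≡y₁ y₁∈i₁
  p₂∣nB : p₂ ∣ n B
  p₂∣nB = primeDividesProgression unique R y₁ y₃ B i₁ i₃ pp₂
    p₂∣n₁n₃ avoid₂ (avoid₃ i₁ p₃∤n₁)
    R∈B R≡y₁ y₁∈i₁ R≡y₃ y₃∈i₃
  p₃∣nB : p₃ ∣ n B
  p₃∣nB = primeDividesProgression unique R y₃ y₂ B i₃ i₂ pp₃
    (subst (p₃ ∣_) (ℕ.*-comm (n i₂) (n i₃)) p₃∣n₂n₃) avoid₃ (avoid₁ i₃ p₁∤n₃)
    R∈B R≡y₃ y₃∈i₃ R≡y₂ y₂∈i₂

-- With Qⱼ = pⱼ^kⱼ, every modulus divides Q₁Q₂Q₃, so a modulus prime to pⱼ divides the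
-- product of the other two Qᵢ; the Qᵢ are pairwise coprime, so they admit a splitting
-- of 1, and the triangle theorem applies.
corollary2 : (k : ℕ) (a : Fin k → ℤ) (n : Fin k → ℕ) → IsECS k a n →
    (p₁ p₂ p₃ k₁ k₂ k₃ : ℕ) → Prime p₁ → Prime p₂ → Prime p₃ →
    p₁ ≢ p₂ → p₁ ≢ p₃ → p₂ ≢ p₃ →
    lcmAll k n ≡ p₁ ^ k₁ * p₂ ^ k₂ * p₃ ^ k₃ →
    (i₁ i₂ i₃ : Fin k) →
    p₁ ∣ n i₁ * n i₂ → p₂ ∣ n i₁ * n i₃ → p₃ ∣ n i₂ * n i₃ →
    ¬ (p₁ ∣ n i₃) → ¬ (p₂ ∣ n i₂) → ¬ (p₃ ∣ n i₁) →
    Σ (Fin k) (λ s → p₁ * p₂ * p₃ ∣ n s)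
corollary2 k a n ecs p₁ p₂ p₃ k₁ k₂ k₃ pp₁ pp₂ pp₃ p₁≢p₂ p₁≢p₃ p₂≢p₃ lcm≡Q₁Q₂Q₃
  i₁ i₂ i₃ p₁∣n₁n₂ p₂∣n₁n₃ p₃∣n₂n₃ p₁∤n₃ p₂∤n₂ p₃∤n₁ =
  map₂ (distinctPrimes∣⇒product∣ pp₁ pp₂ pp₃ p₁≢p₂ p₁≢p₃ p₂≢p₃)
    (triangle ecs pp₁ pp₂ pp₃ (splitting Q₁⊥Q₂Q₃ Q₂⊥Q₃) avoid₁ avoid₂ avoid₃
      i₁ i₂ i₃ p₁∣n₁n₂ p₂∣n₁n₃ p₃∣n₂n₃ p₁∤n₃ p₂∤n₂ p₃∤n₁)
  where
  Q₁ Q₂ Q₃ : ℕ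
  Q₁ = p₁ ^ k₁
  Q₂ = p₂ ^ k₂
  Q₃ = p₃ ^ k₃

  Q₁⊥Q₂Q₃ : Coprime Q₁ (Q₂ * Q₃)
  Q₁⊥Q₂Q₃ = Coprimality.sym (coprime-*ˡ
    (primePowers-coprime pp₂ pp₁ (≢-sym p₁≢p₂) k₂ k₁)
    (primePowers-coprime pp₃ pp₁ (≢-sym p₁≢p₃) k₃ k₁))
  Q₂⊥Q₃ : Coprime Q₂ Q₃
  Q₂⊥Q₃ = primePowers-coprime pp₂ pp₃ p₂≢p₃ k₂ k₃

  modulus∣Q₁Q₂Q₃ : ∀ s → n s ∣ Q₁ * Q₂ * Q₃
  modulus∣Q₁Q₂Q₃ s = subst (n s ∣_) lcm≡Q₁Q₂Q₃ (modulus∣lcmAll k n s)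

  avoid₁ : ∀ s → ¬ (p₁ ∣ n s) → n s ∣ Q₂ * Q₃
  avoid₁ s p₁∤ns = cofactor k₁ (Q₂ * Q₃) pp₁ p₁∤ns
    (subst (n s ∣_) (ℕ.*-assoc Q₁ Q₂ Q₃) (modulus∣Q₁Q₂Q₃ s))
  avoid₂ : ∀ s → ¬ (p₂ ∣ n s) → n s ∣ Q₁ * Q₃
  avoid₂ s p₂∤ns = cofactor k₂ (Q₁ * Q₃) pp₂ p₂∤ns
    (subst (n s ∣_) (trans (cong (_* Q₃) (ℕ.*-comm Q₁ Q₂)) (ℕ.*-assoc Q₂ Q₁ Q₃))
      (modulus∣Q₁Q₂Q₃ s))
  avoid₃ : ∀ s → ¬ (p₃ ∣ n s) → n s ∣ Q₁ * Q₂
  avoid₃ s p₃∤ns = cofactor k₃ (Q₁ * Q₂) pp₃ p₃∤ns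
    (subst (n s ∣_) (ℕ.*-comm (Q₁ * Q₂) Q₃) (modulus∣Q₁Q₂Q₃ s))
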